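{- Let $I=(G,c,R)$ be an MWRPP instance and let $I'=(G',c,R')$ be the DRPP instance where $G'$ is obtained from $G$ by replacing each edge $\{u,v\}$ by the two arcs $(u,v)$ and $(v,u)$, and $R'$ is obtained from $R$ by replacing each edge $\{u,v\}\in R$ by the arc $(u,v)$ if $c(u,v)\le c(v,u)$ and by $(v,u)$ otherwise. Then (i) each feasible solution $T'$ of $I'$ is a feasible solution of the same cost for $I$, and (ii) for each feasible solution $T$ of $I$ there is a feasible solution $T'$ of $I'$ with $c(T')\le 3c(T)$.
   Context: A mixed graph is $G=(V,E,A)$ with a set $E$ of undirected edges and a set $A\subseteq V\times V$ of arcs, no pair of vertices joined by both. Travel costs $c\colon V\times V\to\mathbb N\cup\{0,\infty\}$; traversing edge $\{u,v\}$ from $u$ to $v$ costs $c(u,v)$. A walk is a sequence $(a_1,\dots,a_\ell)$ of pairs $(u,v)$ with $(u,v)\in A$ or $\{u,v\}\in E$ and consecutive head/tail matching; closed if it returns to its start; cost $\sum c(a_i)$. MWRPP: given a mixed graph $G$, costs $c$, and required set $R\subseteq E\cup A$, find a minimum-cost closed walk traversing all of $R$ (edges in either direction); feasible solutions are closed walks traversing all of $R$. DRPP is the case with no undirected edges. -}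

module Defs where

open import Data.Nat using (ℕ; _+_; _≤_; _≤ᵇ_)
open import Data.Bool using (Bool; true; false; if_then_else_)
open import Data.Fin using (Fin)
open import Data.Product using (_×_; _,_; proj₁; proj₂; swap)
open import Data.Sum using (_⊎_)
open import Data.Unit using (⊤)
open import Data.Empty using (⊥)
open import Data.List using (List; []; _∷_; _++_; map)
open import Data.List.Membership.Propositional using (_∈_)
open import Data.List.Relation.Unary.All using (All)
open import Relation.Binary.PropositionalEquality using (_≡_)
open import Relation.Nullary using (¬_)

data ℕ∞ : Set where
  fin : ℕ → ℕ∞
  ∞   : ℕ∞

infixl 6 _+∞_
_+∞_ : ℕ∞ → ℕ∞ → ℕ∞
fin a +∞ fin b = fin (a + b)
fin _ +∞ ∞     = ∞
∞     +∞ _     = ∞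

infix 4 _≤∞_
data _≤∞_ : ℕ∞ → ℕ∞ → Set where
  fin≤fin : ∀ {a b} → a ≤ b → fin a ≤∞ fin b
  _≤∞∞    : ∀ x → x ≤∞ ∞

_≤∞ᵇ_ : ℕ∞ → ℕ∞ → Bool
fin a ≤∞ᵇ fin b = a ≤ᵇ b
_     ≤∞ᵇ ∞     = true
∞     ≤∞ᵇ fin _ = false

-- Vertices are Fin n. A pair (u , v) denotes an arc (u,v), an undirected
-- edge {u,v} (stored in one of its two orientations), or a walk step.

Pair : ℕ → Set
Pair n = Fin n × Fin n

record MWRPP (n : ℕ) : Set where
  field
    edges    : List (Pair n)
    arcs     : List (Pair n)
    cost     : Fin n → Fin n → ℕ∞
    reqEdges : List (Pair n)
    reqArcs  : List (Pair n)

open MWRPP public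

EdgeIn : ∀ {n} → List (Pair n) → Pair n → Set
EdgeIn E e = e ∈ E ⊎ swap e ∈ E

Valid : ∀ {n} → MWRPP n → Set
Valid I =
  (∀ a → a ∈ arcs I → ¬ EdgeIn (edges I) a)
  × All (EdgeIn (edges I)) (reqEdges I)
  × All (_∈ arcs I) (reqArcs I)

Step : ∀ {n} → MWRPP n → Pair n → Set
Step I a = a ∈ arcs I ⊎ EdgeIn (edges I) a

Walk : ℕ → Set
Walk n = List (Pair n)

Consecutive : ∀ {n} → Walk n → Set
Consecutive []                = ⊤
Consecutive (_ ∷ [])          = ⊤
Consecutive (a ∷ b ∷ w)       = proj₂ a ≡ proj₁ b × Consecutive (b ∷ w)

lastHead : ∀ {n} → Pair n → Walk n → Fin n
lastHead a []      = proj₂ a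
lastHead _ (b ∷ w) = lastHead b w

Closes : ∀ {n} → Walk n → Set
Closes []      = ⊤
Closes (a ∷ w) = lastHead a w ≡ proj₁ a

IsClosedWalk : ∀ {n} → MWRPP n → Walk n → Set
IsClosedWalk I w = All (Step I) w × Consecutive w × Closes w

Feasible : ∀ {n} → MWRPP n → Walk n → Set
Feasible I w =
  IsClosedWalk I w
  × All (_∈ w) (reqArcs I)
  × All (λ e → e ∈ w ⊎ swap e ∈ w) (reqEdges I)

walkCost : ∀ {n} → (Fin n → Fin n → ℕ∞) → Walk n → ℕ∞
walkCost c []            = fin 0
walkCost c ((u , v) ∷ w) = c u v +∞ walkCost c w

costOf : ∀ {n} → MWRPP n → Walk n → ℕ∞
costOf I w = walkCost (cost I) w

orient : ∀ {n} → (Fin n → Fin n → ℕ∞) → Pair n → Pair n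
orient c (u , v) = if c u v ≤∞ᵇ c v u then (u , v) else (v , u)

toDRPP : ∀ {n} → MWRPP n → MWRPP n
toDRPP I = record
  { edges    = []
  ; arcs     = arcs I ++ edges I ++ map swap (edges I)
  ; cost     = cost I
  ; reqEdges = []
  ; reqArcs  = reqArcs I ++ map (orient (cost I)) (reqEdges I)
  }

module Submission where

-- (i)  Every step allowed in I' is allowed in I, the costs coincide, and a
--      required arc orient c e of I' traversed by a walk means e is traversed
--      in one of its directions; so a feasible T' for I' is feasible for I.
-- (ii) Given a feasible T for I, expand each of its steps s = (u,v):
--      an arc step stays as it is; an edge step stays as it is when the
--      forward direction is strictly cheaper, and otherwise becomes the
--      detour (u,v),(v,u),(u,v), of cost at most 3 c(u,v) because
--      c(v,u) ≤ c(u,v).  Either way the piece contains both orientations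
--      orient c (u,v) and orient c (v,u), so every required edge of I is
--      covered in its prescribed direction.

open import Defs
open import Data.Nat using (_+_)
open import Data.Nat.Properties
  using (≤ᵇ⇒≤; ≤⇒≤ᵇ; ≤-total; ≤-refl; ≤-reflexive; ≤-trans; +-mono-≤; +-monoʳ-≤; m≤m+n; +-assoc; +-identityʳ)
open import Data.Nat.Tactic.RingSolver using (solve-∀)
open import Data.Bool using (Bool; true; false; T; if_then_else_)
open import Data.Bool.Properties using (T-≡)
open import Data.Unit using (tt)
open import Data.Empty using (⊥-elim)
open import Data.Fin using (Fin)
open import Data.Product using (_×_; ∃; _,_; proj₁; proj₂; swap)
open import Data.Sum using (_⊎_; inj₁; inj₂)
open import Data.List using ([]; _∷_; _++_)
open import Data.List.Membership.Propositional using (_∈_)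
open import Data.List.Membership.Propositional.Properties using (∈-++⁺ˡ; ∈-++⁺ʳ; ∈-++⁻; ∈-map⁺; ∈-map⁻)
open import Data.List.Relation.Unary.All as All using (All; []; _∷_)
import Data.List.Relation.Unary.All.Properties as All
open import Data.List.Relation.Unary.Any using (here; there)
open import Function.Bundles using (Equivalence)
open import Relation.Binary.PropositionalEquality using (_≡_; refl; sym; trans; cong; subst; subst₂)

≤∞ᵇ-sound : ∀ x y → x ≤∞ᵇ y ≡ true → x ≤∞ y
≤∞ᵇ-sound (fin a) (fin b) a≤ᵇb = fin≤fin (≤ᵇ⇒≤ a b (Equivalence.from T-≡ a≤ᵇb))
≤∞ᵇ-sound (fin a) ∞       _    = _ ≤∞∞
≤∞ᵇ-sound ∞       ∞       _    = _ ≤∞∞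
≤∞ᵇ-sound ∞       (fin b) ()

≤∞ᵇ-total : ∀ x y → x ≤∞ᵇ y ≡ false → y ≤∞ᵇ x ≡ true
≤∞ᵇ-total (fin a) (fin b) a≰ᵇb with ≤-total b a
... | inj₁ b≤a = Equivalence.to T-≡ (≤⇒≤ᵇ b≤a)
... | inj₂ a≤b = ⊥-elim (subst T a≰ᵇb (≤⇒≤ᵇ a≤b))
≤∞ᵇ-total ∞ (fin b) _ = refl

+∞-identityˡ : ∀ x → fin 0 +∞ x ≡ x
+∞-identityˡ (fin a) = refl
+∞-identityˡ ∞       = refl

+∞-identityʳ : ∀ x → x +∞ fin 0 ≡ x
+∞-identityʳ (fin a) = cong fin (+-identityʳ a)
+∞-identityʳ ∞       = refl

+∞-assoc : ∀ x y z → (x +∞ y) +∞ z ≡ x +∞ (y +∞ z)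
+∞-assoc (fin a) (fin b) (fin c) = cong fin (+-assoc a b c)
+∞-assoc (fin a) (fin b) ∞       = refl
+∞-assoc (fin a) ∞       z       = refl
+∞-assoc ∞       y       z       = refl

+∞-mono-≤∞ : ∀ {x x' y y'} → x ≤∞ x' → y ≤∞ y' → x +∞ y ≤∞ x' +∞ y'
+∞-mono-≤∞ (fin≤fin a≤a') (fin≤fin b≤b') = fin≤fin (+-mono-≤ a≤a' b≤b')
+∞-mono-≤∞ (fin≤fin a≤a') (_ ≤∞∞)        = _ ≤∞∞
+∞-mono-≤∞ (_ ≤∞∞)        _              = _ ≤∞∞

-- Three times a cost, written as a sum as in the statement of Lemma 3.
thrice : ℕ∞ → ℕ∞
thrice x = x +∞ x +∞ x

thrice-+∞ : ∀ x y → thrice x +∞ thrice y ≡ thrice (x +∞ y)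
thrice-+∞ (fin a) (fin b) = cong fin (thrice-+ a b)
  where
  thrice-+ : ∀ a b → (a + a + a) + (b + b + b) ≡ (a + b) + (a + b) + (a + b)
  thrice-+ = solve-∀
thrice-+∞ (fin a) ∞       = refl
thrice-+∞ ∞       y       = refl

single≤thrice : ∀ x → x +∞ fin 0 ≤∞ thrice x
single≤thrice (fin a) = fin≤fin (≤-trans (≤-reflexive (+-identityʳ a)) (≤-trans (m≤m+n a (a + a)) (≤-reflexive (sym (+-assoc a a a)))))
single≤thrice ∞       = _ ≤∞∞

detour≤thrice : ∀ x y → y ≤∞ x → x +∞ (y +∞ (x +∞ fin 0)) ≤∞ thrice x
detour≤thrice (fin a) (fin b) (fin≤fin b≤a) =
  fin≤fin (≤-trans (+-monoʳ-≤ a (+-mono-≤ b≤a (≤-reflexive (+-identityʳ a)))) (≤-reflexive (sym (+-assoc a a a))))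
detour≤thrice ∞ y _ = _ ≤∞∞

data Path {n} : Fin n → Fin n → Walk n → Set where
  []   : ∀ {x} → Path x x []
  step : ∀ {x y a w} → x ≡ proj₁ a → Path (proj₂ a) y w → Path x y (a ∷ w)

_++ᴾ_ : ∀ {n} {x y z} {w₁ w₂ : Walk n} → Path x y w₁ → Path y z w₂ → Path x z (w₁ ++ w₂)
[]       ++ᴾ q = q
step e p ++ᴾ q = step e (p ++ᴾ q)

consecutive⇒path : ∀ {n} (a : Pair n) w → Consecutive (a ∷ w) → Path (proj₁ a) (lastHead a w) (a ∷ w)
consecutive⇒path a []      _       = step refl []
consecutive⇒path a (b ∷ w) (e , c) = step refl (subst (λ x → Path x _ _) (sym e) (consecutive⇒path b w c))

path⇒consecutive : ∀ {n} {x y} {a : Pair n} {w} → Path x y (a ∷ w) → Consecutive (a ∷ w) × lastHead a w ≡ y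
path⇒consecutive (step _ [])              = tt , refl
path⇒consecutive (step _ rest@(step e _)) = let (c , l) = path⇒consecutive rest in (e , c) , l

closed⇒path : ∀ {n} (a : Pair n) w → Consecutive (a ∷ w) → Closes (a ∷ w) → Path (proj₁ a) (proj₁ a) (a ∷ w)
closed⇒path a w c cl = subst (λ y → Path (proj₁ a) y (a ∷ w)) cl (consecutive⇒path a w c)

path⇒closed : ∀ {n} {x} {w : Walk n} → Path x x w → Consecutive w × Closes w
path⇒closed []           = tt , tt
path⇒closed p@(step e _) = let (c , l) = path⇒consecutive p in c , trans l e

walkCost-++ : ∀ {n} (c : Fin n → Fin n → ℕ∞) w₁ w₂ → walkCost c (w₁ ++ w₂) ≡ walkCost c w₁ +∞ walkCost c w₂
walkCost-++ c []             w₂ = sym (+∞-identityˡ (walkCost c w₂))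
walkCost-++ c ((u , v) ∷ w₁) w₂ =
  trans (cong (c u v +∞_) (walkCost-++ c w₁ w₂)) (sym (+∞-assoc (c u v) (walkCost c w₁) (walkCost c w₂)))

module Expansion {n} {P : Pair n → Set} (piece : ∀ s → P s → Walk n) where

  expand : (T : Walk n) → All P T → Walk n
  expand []      []       = []
  expand (s ∷ T) (p ∷ ps) = piece s p ++ expand T ps

  expand-path : (∀ s p → Path (proj₁ s) (proj₂ s) (piece s p)) →
                ∀ {x y} T ps → Path x y T → Path x y (expand T ps)
  expand-path piece-path []      []       []            = []
  expand-path piece-path (s ∷ T) (p ∷ ps) (step refl q) = piece-path s p ++ᴾ expand-path piece-path T ps q

  expand-closed : (∀ s p → Path (proj₁ s) (proj₂ s) (piece s p)) →
                  ∀ T ps → Consecutive T → Closes T → Consecutive (expand T ps) × Closes (expand T ps)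
  expand-closed piece-path []      []       _ _  = tt , tt
  expand-closed piece-path (a ∷ w) (p ∷ ps) c cl =
    path⇒closed (expand-path piece-path (a ∷ w) (p ∷ ps) (closed⇒path a w c cl))

  expand-∈ : ∀ T ps {s} (s∈T : s ∈ T) {a} → a ∈ piece s (All.lookup ps s∈T) → a ∈ expand T ps
  expand-∈ (s ∷ T) (p ∷ ps) (here refl) a∈ = ∈-++⁺ˡ a∈
  expand-∈ (s ∷ T) (p ∷ ps) (there s∈T) a∈ = ∈-++⁺ʳ (piece s p) (expand-∈ T ps s∈T a∈)

  expand-All : ∀ {Q : Pair n → Set} → (∀ s p → All Q (piece s p)) → ∀ T ps → All Q (expand T ps)
  expand-All piece-Q []      []       = []
  expand-All piece-Q (s ∷ T) (p ∷ ps) = All.++⁺ (piece-Q s p) (expand-All piece-Q T ps)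

  expand-cost : (c : Fin n → Fin n → ℕ∞) →
                (∀ s p → walkCost c (piece s p) ≤∞ thrice (c (proj₁ s) (proj₂ s))) →
                ∀ T ps → walkCost c (expand T ps) ≤∞ thrice (walkCost c T)
  expand-cost c piece-cost []      []       = fin≤fin ≤-refl
  expand-cost c piece-cost (s ∷ T) (p ∷ ps) =
    subst₂ _≤∞_ (sym (walkCost-++ c (piece s p) (expand T ps))) (thrice-+∞ (c (proj₁ s) (proj₂ s)) (walkCost c T))
      (+∞-mono-≤∞ (piece-cost s p) (expand-cost c piece-cost T ps))

module EdgePiece {n} (c : Fin n → Fin n → ℕ∞) where

  reverseCheap : Pair n → Bool
  reverseCheap (u , v) = c v u ≤∞ᵇ c u v

  edgePiece : Pair n → Walk n
  edgePiece s = if reverseCheap s then s ∷ swap s ∷ s ∷ [] else s ∷ []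

  edgePiece-path : ∀ s → Path (proj₁ s) (proj₂ s) (edgePiece s)
  edgePiece-path s with reverseCheap s
  ... | true  = step refl (step refl (step refl []))
  ... | false = step refl []

  edgePiece-head : ∀ s → s ∈ edgePiece s
  edgePiece-head s with reverseCheap s
  ... | true  = here refl
  ... | false = here refl

  edgePiece-All : ∀ {Q : Pair n → Set} s → Q s → Q (swap s) → All Q (edgePiece s)
  edgePiece-All s qs qs' with reverseCheap s
  ... | true  = qs ∷ qs' ∷ qs ∷ []
  ... | false = qs ∷ []

  edgePiece-cost : ∀ u v → walkCost c (edgePiece (u , v)) ≤∞ thrice (c u v)
  edgePiece-cost u v with reverseCheap (u , v) in cheap
  ... | true  = detour≤thrice (c u v) (c v u) (≤∞ᵇ-sound (c v u) (c u v) cheap)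
  ... | false = single≤thrice (c u v)

  -- When going backwards is strictly dearer, orient keeps (u,v); by
  -- definition it then also turns (v,u) into (u,v).
  orient-forward : ∀ u v → reverseCheap (u , v) ≡ false → orient c (u , v) ≡ (u , v)
  orient-forward u v dear rewrite ≤∞ᵇ-total (c v u) (c u v) dear = refl

  orient-either : ∀ u v → orient c (u , v) ≡ (u , v) ⊎ orient c (u , v) ≡ (v , u)
  orient-either u v with c u v ≤∞ᵇ c v u
  ... | true  = inj₁ refl
  ... | false = inj₂ refl

  -- The piece contains the orientation of its edge that I' requires, no
  -- matter in which direction the edge is stored.
  edgePiece-orient : ∀ u v → orient c (u , v) ∈ edgePiece (u , v) × orient c (v , u) ∈ edgePiece (u , v)
  edgePiece-orient u v with reverseCheap (u , v) in cheap
  ... | true  = in-detour (orient-either u v) , there (here refl)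
    where
    in-detour : ∀ {a} → a ≡ (u , v) ⊎ a ≡ (v , u) → a ∈ (u , v) ∷ (v , u) ∷ (u , v) ∷ []
    in-detour (inj₁ refl) = here refl
    in-detour (inj₂ refl) = there (here refl)
  ... | false = subst (_∈ _) (sym (orient-forward u v cheap)) (here refl) , here refl

module _ {n} (I : MWRPP n) where
  open EdgePiece (cost I)

  I' : MWRPP n
  I' = toDRPP I

  EdgeIn-swap : ∀ {s} → EdgeIn (edges I) s → EdgeIn (edges I) (swap s)
  EdgeIn-swap (inj₁ s∈E) = inj₂ s∈E
  EdgeIn-swap (inj₂ s∈E) = inj₁ s∈E

  arc'⇒step : ∀ {a} → a ∈ arcs I' → Step I a
  arc'⇒step a∈A' with ∈-++⁻ (arcs I) a∈A'
  ... | inj₁ a∈A = inj₁ a∈A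
  ... | inj₂ a∈E∪E⁻¹ with ∈-++⁻ (edges I) a∈E∪E⁻¹
  ... | inj₁ a∈E = inj₂ (inj₁ a∈E)
  ... | inj₂ a∈E⁻¹ with ∈-map⁻ swap a∈E⁻¹
  ... | e , e∈E , refl = inj₂ (inj₂ e∈E)

  edge⇒arc' : ∀ {s} → EdgeIn (edges I) s → s ∈ arcs I'
  edge⇒arc' (inj₁ s∈E)  = ∈-++⁺ʳ (arcs I) (∈-++⁺ˡ s∈E)
  edge⇒arc' (inj₂ s⁻∈E) = ∈-++⁺ʳ (arcs I) (∈-++⁺ʳ (edges I) (∈-map⁺ swap s⁻∈E))

  -- I' has no edges, so each of its steps is an arc of I', hence a step of I.
  step'⇒step : ∀ {a} → Step I' a → Step I a
  step'⇒step (inj₁ a∈A')     = arc'⇒step a∈A'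
  step'⇒step (inj₂ (inj₁ ()))
  step'⇒step (inj₂ (inj₂ ()))

  orient⇒traversed : ∀ {w : Walk n} e → orient (cost I) e ∈ w → e ∈ w ⊎ swap e ∈ w
  orient⇒traversed (u , v) o∈w with cost I u v ≤∞ᵇ cost I v u
  ... | true  = inj₁ o∈w
  ... | false = inj₂ o∈w

  feasible'⇒feasible : (T' : Walk n) → Feasible I' T' → Feasible I T' × costOf I T' ≡ costOf I' T'
  feasible'⇒feasible T' ((steps , closed) , reqArcs∈T' , _) =
    ((All.map step'⇒step steps , closed) , reqA∈T' , All.map (λ {e} → orient⇒traversed e) reqE∈T') , refl
    where
    reqA∈T' : All (_∈ T') (reqArcs I)
    reqA∈T' = proj₁ (All.++⁻ (reqArcs I) reqArcs∈T')

    reqE∈T' : All (λ e → orient (cost I) e ∈ T') (reqEdges I)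
    reqE∈T' = All.map⁻ (proj₂ (All.++⁻ (reqArcs I) reqArcs∈T'))

  piece : ∀ s → Step I s → Walk n
  piece s (inj₁ _) = s ∷ []
  piece s (inj₂ _) = edgePiece s

  open Expansion piece

  piece-path : ∀ s p → Path (proj₁ s) (proj₂ s) (piece s p)
  piece-path s (inj₁ _) = step refl []
  piece-path s (inj₂ _) = edgePiece-path s

  piece-head : ∀ s p → s ∈ piece s p
  piece-head s (inj₁ _) = here refl
  piece-head s (inj₂ _) = edgePiece-head s

  piece-steps : ∀ s p → All (Step I') (piece s p)
  piece-steps s (inj₁ s∈A) = inj₁ (∈-++⁺ˡ s∈A) ∷ []
  piece-steps s (inj₂ s∈E) = edgePiece-All s (inj₁ (edge⇒arc' s∈E)) (inj₁ (edge⇒arc' (EdgeIn-swap s∈E)))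

  piece-cost : ∀ s p → walkCost (cost I) (piece s p) ≤∞ thrice (cost I (proj₁ s) (proj₂ s))
  piece-cost s (inj₁ _) = single≤thrice (cost I (proj₁ s) (proj₂ s))
  piece-cost s (inj₂ _) = edgePiece-cost (proj₁ s) (proj₂ s)

  -- In a valid instance an edge step is never an arc, so its piece contains
  -- both orientations required by I'.
  piece-orient : Valid I → ∀ s → EdgeIn (edges I) s → (p : Step I s) →
                 orient (cost I) s ∈ piece s p × orient (cost I) (swap s) ∈ piece s p
  piece-orient (arc∉E , _) s s∈E (inj₁ s∈A) = ⊥-elim (arc∉E s s∈A s∈E)
  piece-orient _           s s∈E (inj₂ _)   = edgePiece-orient (proj₁ s) (proj₂ s)

  feasible⇒feasible' : Valid I → (T : Walk n) → Feasible I T →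
                       ∃ λ T' → Feasible I' T' × costOf I' T' ≤∞ thrice (costOf I T)
  feasible⇒feasible' valid@(_ , reqE⊆E , _) T ((steps , consecutive , closes) , reqA∈T , reqE∈T) =
    expand T steps
    , ( (expand-All piece-steps T steps , expand-closed piece-path T steps consecutive closes)
      , All.++⁺ reqA∈T' (All.map⁺ reqE∈T')
      , [] )
    , expand-cost (cost I) piece-cost T steps
    where
    reqA∈T' : All (_∈ expand T steps) (reqArcs I)
    reqA∈T' = All.map (λ {r} r∈T → expand-∈ T steps r∈T (piece-head r (All.lookup steps r∈T))) reqA∈T

    covered : ∀ e → EdgeIn (edges I) e → e ∈ T ⊎ swap e ∈ T → orient (cost I) e ∈ expand T steps
    covered e e∈E (inj₁ e∈T)  =
      expand-∈ T steps e∈T (proj₁ (piece-orient valid e e∈E (All.lookup steps e∈T)))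
    covered e e∈E (inj₂ e⁻∈T) =
      expand-∈ T steps e⁻∈T (proj₂ (piece-orient valid (swap e) (EdgeIn-swap e∈E) (All.lookup steps e⁻∈T)))

    reqE∈T' : All (λ e → orient (cost I) e ∈ expand T steps) (reqEdges I)
    reqE∈T' = All.zipWith (λ {e} (e∈E , e∈T) → covered e e∈E e∈T) (reqE⊆E , reqE∈T)

lemma3 : ∀ {n} (I : MWRPP n) → Valid I →
    ((T' : Walk n) → Feasible (toDRPP I) T' →
       Feasible I T' × costOf I T' ≡ costOf (toDRPP I) T')
    × ((T : Walk n) → Feasible I T →
       ∃ λ T' → Feasible (toDRPP I) T' × costOf (toDRPP I) T' ≤∞ costOf I T +∞ costOf I T +∞ costOf I T)
lemma3 I valid = feasible'⇒feasible I , feasible⇒feasible' I valid
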